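{- Let $k$ be a positive integer and let $G$ be a directed acyclic graph on $n>10k$ vertices such that every induced subgraph of $G$ on $k$ vertices has at least one edge. Then there exist a vertex $u$ and sets of vertices $S_-,S_+$ such that for all $x\in S_-$ we have $x\prec u$, for all $x\in S_+$ we have $u\prec x$, and $|S_-|\ge \frac{n}{3k}$ and $|S_+|\ge \frac{n}{3k}$.
   Context: For vertices $x,y$ of the directed acyclic graph $G$, $x\prec y$ means that there is a directed path from $x$ to $y$ in $G$. ``Edge'' in the hypothesis on induced subgraphs means an edge in either direction. -}

module Defs where

open import Level using (0ℓ)
open import Data.Nat using (ℕ; _*_; _≤_; _>_)
open import Data.Fin using (Fin)
open import Data.Fin.Subset using (Subset; _∈_; ∣_∣)
open import Data.Product using (∃₂; _×_)
open import Relation.Nullary using (¬_)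
open import Relation.Binary using (Rel; Decidable)
open import Relation.Binary.Construct.Closure.Transitive using (TransClosure)
open import Function.Definitions using (Injective)
open import Relation.Binary.PropositionalEquality using (_≡_)

-- A directed graph on vertex set Fin n: edge relation E x y means an edge x → y.
-- Reachability x ≺ y : there is a directed path (of length ≥ 1) from x to y.
Reach : ∀ {n} → Rel (Fin n) 0ℓ → Rel (Fin n) 0ℓ
Reach E = TransClosure E

Acyclic : ∀ {n} → Rel (Fin n) 0ℓ → Set
Acyclic E = ∀ x → ¬ Reach E x x

EveryKSetHasEdge : ∀ {n} → ℕ → Rel (Fin n) 0ℓ → Set
EveryKSetHasEdge {n} k E =
  (f : Fin k → Fin n) → Injective _≡_ _≡_ f → ∃₂ λ i j → E (f i) (f j)

-- Rank each vertex by its number of ancestors. Reachability strictly increases the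
-- rank, so every rank level contains no edge and therefore has fewer than k vertices;
-- hence at most c k vertices have rank below c. Doing the same with descendants and
-- taking c = ⌊n / 3k⌋ + 1, the 2 c k < n vertices of small ancestor or small
-- descendant rank cannot exhaust the graph, and any remaining vertex u has at least c
-- ancestors and at least c descendants, where 3 k c ≥ n.
module Submission where

open import Level using (0ℓ)
open import Data.Nat using (ℕ; zero; suc; _+_; _*_; _≤_; _<_; z≤n; s≤s; s≤s⁻¹; z<s; s<s; _≟_; _≤?_; _<?_)
open import Data.Nat.Properties
  using ( ≤-reflexive; ≤-trans; ≤-antisym; ≤-<-trans; <⇒≤; <⇒≢; <⇒≱; ≮⇒≥; ≰⇒>; m≤m+n; +-suc; +-comm; *-comm
        ; +-mono-≤; +-monoˡ-≤; +-monoʳ-≤; +-monoˡ-<; +-monoʳ-<; *-monoˡ-≤; *-monoʳ-≤; *-cancelˡ-<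
        ; anyUpTo?; module ≤-Reasoning)
open import Data.Nat.DivMod using (_/_; _%_; m≡m%n+[m/n]*n; m%n<n; m/n*n≤m)
open import Data.Nat.Solver using (module +-*-Solver)
open import Data.Fin using (Fin; inject≤) renaming (zero to fzero; suc to fsuc; _<_ to _<ᶠ_)
open import Data.Fin.Properties using (any?; pigeonhole; inject≤-injective)
  renaming (suc-injective to fsuc-injective; _≟_ to _≟ᶠ_)
open import Data.Fin.Subset using (Subset; _∈_; _∉_; _⊆_; _∪_; ∣_∣; inside; outside; ⊤; ⊥)
open import Data.Fin.Subset.Properties
  using (_∈?_; ∣p∣≤∣x∷p∣; ∣⊤∣≡n; ∣⊥∣≡0; x∈p∪q⁺; p⊆q⇒∣p∣≤∣q∣; p⊂q⇒∣p∣<∣q∣)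
open import Data.Product using (Σ; ∃; ∃₂; _×_; _,_)
open import Data.Sum using (inj₁; inj₂)
open import Data.Vec using ([]; _∷_; tabulate; here; there)
open import Function using (_∘_; flip)
open import Function.Definitions using (Injective)
open import Relation.Nullary using (¬_; yes; no; does; contradiction)
open import Relation.Nullary.Decidable using (_×-dec_; ¬?; map′)
open import Relation.Unary using (Pred) renaming (Decidable to Decidable₁)
open import Relation.Binary using (Rel; Decidable; Transitive; _⇒_)
open import Relation.Binary.PropositionalEquality using (_≡_; refl; sym; trans; cong; subst)
open import Relation.Binary.Construct.Closure.Transitive using ([_]; _∷_; _++_)

open import Defs

private
  variable
    n k : ℕ

subset : {P : Pred (Fin n) 0ℓ} → Decidable₁ P → Subset n
subset P? = tabulate (does ∘ P?)

∈-subset⁻ : {P : Pred (Fin n) 0ℓ} (P? : Decidable₁ P) {x : Fin n} → x ∈ subset P? → P x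
∈-subset⁻ P? {fzero} x∈ with P? fzero | x∈
... | yes Px | _ = Px
... | no _   | ()
∈-subset⁻ P? {fsuc x} (there x∈) = ∈-subset⁻ (P? ∘ fsuc) x∈

∈-subset⁺ : {P : Pred (Fin n) 0ℓ} (P? : Decidable₁ P) {x : Fin n} → P x → x ∈ subset P?
∈-subset⁺ P? {fzero} Px with P? fzero
... | yes _  = here
... | no ¬Px = contradiction Px ¬Px
∈-subset⁺ P? {fsuc x} Px = there (∈-subset⁺ (P? ∘ fsuc) Px)

∣p∪q∣≤∣p∣+∣q∣ : (p q : Subset n) → ∣ p ∪ q ∣ ≤ ∣ p ∣ + ∣ q ∣
∣p∪q∣≤∣p∣+∣q∣ []            []            = z≤n
∣p∪q∣≤∣p∣+∣q∣ (outside ∷ p) (outside ∷ q) = ∣p∪q∣≤∣p∣+∣q∣ p q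
∣p∪q∣≤∣p∣+∣q∣ (outside ∷ p) (inside  ∷ q) =
  ≤-trans (s≤s (∣p∪q∣≤∣p∣+∣q∣ p q)) (≤-reflexive (sym (+-suc ∣ p ∣ ∣ q ∣)))
∣p∪q∣≤∣p∣+∣q∣ (inside  ∷ p) (t       ∷ q) =
  s≤s (≤-trans (∣p∪q∣≤∣p∣+∣q∣ p q) (+-monoʳ-≤ ∣ p ∣ (∣p∣≤∣x∷p∣ t q)))

∣p∣+∣q∣<n⇒∃x∉p∪q : (p q : Subset n) → ∣ p ∣ + ∣ q ∣ < n → ∃ λ x → x ∉ p × x ∉ q
∣p∣+∣q∣<n⇒∃x∉p∪q {n} p q small with any? (λ x → ¬? (x ∈? p) ×-dec ¬? (x ∈? q))
... | yes found = found
... | no none   = contradiction n≤∣p∣+∣q∣ (<⇒≱ small)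
  where
  ⊤⊆p∪q : ⊤ {n} ⊆ p ∪ q
  ⊤⊆p∪q {x} _ with x ∈? p | x ∈? q
  ... | yes x∈p | _       = x∈p∪q⁺ (inj₁ x∈p)
  ... | no _    | yes x∈q = x∈p∪q⁺ (inj₂ x∈q)
  ... | no x∉p  | no x∉q  = contradiction (x , x∉p , x∉q) none

  n≤∣p∣+∣q∣ : n ≤ ∣ p ∣ + ∣ q ∣
  n≤∣p∣+∣q∣ = begin
    n             ≡⟨ ∣⊤∣≡n n ⟨
    ∣ ⊤ {n} ∣     ≤⟨ p⊆q⇒∣p∣≤∣q∣ ⊤⊆p∪q ⟩
    ∣ p ∪ q ∣     ≤⟨ ∣p∪q∣≤∣p∣+∣q∣ p q ⟩
    ∣ p ∣ + ∣ q ∣ ∎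
    where open ≤-Reasoning

enumerate : (p : Subset n) → Fin ∣ p ∣ → Fin n
enumerate (outside ∷ p) i        = fsuc (enumerate p i)
enumerate (inside  ∷ p) fzero    = fzero
enumerate (inside  ∷ p) (fsuc i) = fsuc (enumerate p i)

enumerate-∈ : (p : Subset n) (i : Fin ∣ p ∣) → enumerate p i ∈ p
enumerate-∈ (outside ∷ p) i        = there (enumerate-∈ p i)
enumerate-∈ (inside  ∷ p) fzero    = here
enumerate-∈ (inside  ∷ p) (fsuc i) = there (enumerate-∈ p i)

enumerate-injective : (p : Subset n) → Injective _≡_ _≡_ (enumerate p)
enumerate-injective (outside ∷ p) eq = enumerate-injective p (fsuc-injective eq)
enumerate-injective (inside  ∷ p) {fzero}  {fzero}  eq = refl
enumerate-injective (inside  ∷ p) {fsuc i} {fsuc j} eq =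
  cong fsuc (enumerate-injective p (fsuc-injective eq))

EveryKSetHasEdge-map : {E R : Rel (Fin n) 0ℓ} → E ⇒ R → EveryKSetHasEdge k E → EveryKSetHasEdge k R
EveryKSetHasEdge-map E⇒R hasEdge f f-inj = let i , j , e = hasEdge f f-inj in i , j , E⇒R e

EveryKSetHasEdge-flip : {R : Rel (Fin n) 0ℓ} → EveryKSetHasEdge k R → EveryKSetHasEdge k (flip R)
EveryKSetHasEdge-flip hasEdge f f-inj = let i , j , r = hasEdge f f-inj in j , i , r

edge-in-large-subset : {R : Rel (Fin n) 0ℓ} → EveryKSetHasEdge k R →
  (p : Subset n) → k ≤ ∣ p ∣ → ∃₂ λ x y → x ∈ p × y ∈ p × R x y
edge-in-large-subset {k = k} hasEdge p k≤∣p∣ =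
  let i , j , r = hasEdge f f-inj in f i , f j , enumerate-∈ p _ , enumerate-∈ p _ , r
  where
  f : Fin k → Fin _
  f i = enumerate p (inject≤ i k≤∣p∣)

  f-inj : Injective _≡_ _≡_ f
  f-inj eq = inject≤-injective _ _ _ _ (enumerate-injective p eq)

module _ {n : ℕ} (E : Rel (Fin n) 0ℓ) where

  data Walk : ℕ → Rel (Fin n) 0ℓ where
    []  : ∀ {x} → Walk 0 x x
    _∷_ : ∀ {ℓ x y z} → E x y → Walk ℓ y z → Walk (suc ℓ) x z

  vertex : ∀ {ℓ x y} → Walk ℓ x y → Fin (suc ℓ) → Fin n
  vertex {x = x} w       fzero    = x
  vertex         (e ∷ w) (fsuc i) = vertex w i

  vertex-reach : ∀ {ℓ x y} (w : Walk ℓ x y) {i j : Fin (suc ℓ)} →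
    i <ᶠ j → Reach E (vertex w i) (vertex w j)
  vertex-reach (e ∷ w) {fzero}  {fsuc fzero}    _         = [ e ]
  vertex-reach (e ∷ w) {fzero}  {fsuc (fsuc j)} _         = e ∷ vertex-reach w {fzero} {fsuc j} z<s
  vertex-reach (e ∷ w) {fsuc i} {fsuc j}        (s<s i<j) = vertex-reach w i<j

  walk-length : Acyclic E → ∀ {ℓ x y} → Walk ℓ x y → ℓ < n
  walk-length acyclic {ℓ} w with ℓ <? n
  ... | yes ℓ<n = ℓ<n
  ... | no ℓ≮n with pigeonhole (s≤s (≮⇒≥ ℓ≮n)) (vertex w)
  ...   | i , j , i<j , same = contradiction (subst (Reach E _) (sym same) (vertex-reach w i<j)) (acyclic _)

  walk⇒reach : ∀ {ℓ x y} → Walk (suc ℓ) x y → Reach E x y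
  walk⇒reach (e ∷ [])        = [ e ]
  walk⇒reach (e ∷ w@(_ ∷ _)) = e ∷ walk⇒reach w

  reach⇒walk : ∀ {x y} → Reach E x y → ∃ λ ℓ → Walk (suc ℓ) x y
  reach⇒walk [ e ]   = 0 , e ∷ []
  reach⇒walk (e ∷ r) with reach⇒walk r
  ... | ℓ , w = suc ℓ , e ∷ w

  module _ (E? : Decidable E) where

    walk? : ∀ ℓ → Decidable (Walk ℓ)
    walk? zero    x y with x ≟ᶠ y
    ... | yes refl = yes []
    ... | no x≢y   = no λ { [] → x≢y refl }
    walk? (suc ℓ) x z = map′ (λ (y , e , w) → e ∷ w) (λ { (e ∷ w) → _ , e , w })
                          (any? λ y → E? x y ×-dec walk? ℓ y z)

    -- Acyclicity bounds the length of a walk by n, which makes the search for one finite.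
    Reach? : Acyclic E → Decidable (Reach E)
    Reach? acyclic x y = map′ (λ (_ , _ , w) → walk⇒reach w) short-walk
                           (anyUpTo? (λ ℓ → walk? (suc ℓ) x y) n)
      where
      short-walk : Reach E x y → ∃ λ ℓ → ℓ < n × Walk (suc ℓ) x y
      short-walk r with reach⇒walk r
      ... | ℓ , w = ℓ , <⇒≤ (walk-length acyclic w) , w

module Ranking {n : ℕ} {_≺_ : Rel (Fin n) 0ℓ} (_≺?_ : Decidable _≺_)
               (≺-trans : Transitive _≺_) (≺-irrefl : ∀ x → ¬ x ≺ x) where

  predecessors : Fin n → Subset n
  predecessors v = subset (_≺? v)

  rank : Fin n → ℕ
  rank v = ∣ predecessors v ∣

  rank-mono : ∀ {x y} → x ≺ y → rank x < rank y
  rank-mono {x} {y} x≺y =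
    p⊂q⇒∣p∣<∣q∣ (predecessors-mono , x , ∈-subset⁺ (_≺? y) x≺y , ≺-irrefl x ∘ ∈-subset⁻ (_≺? x))
    where
    predecessors-mono : predecessors x ⊆ predecessors y
    predecessors-mono z∈ = ∈-subset⁺ (_≺? y) (≺-trans (∈-subset⁻ (_≺? x) z∈) x≺y)

  level : ℕ → Subset n
  level c = subset (λ v → rank v ≟ c)

  levelsBelow : ℕ → Subset n
  levelsBelow c = subset (λ v → rank v <? c)

  ∉levelsBelow⇒≥ : ∀ {c v} → v ∉ levelsBelow c → c ≤ rank v
  ∉levelsBelow⇒≥ {c} v∉ = ≮⇒≥ (v∉ ∘ ∈-subset⁺ (λ v → rank v <? c))

  module _ {k : ℕ} (hasEdge : EveryKSetHasEdge k _≺_) where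

    ∣level∣<k : ∀ c → ∣ level c ∣ < k
    ∣level∣<k c with k ≤? ∣ level c ∣
    ... | no k≰ = ≰⇒> k≰
    ... | yes k≤ with edge-in-large-subset hasEdge (level c) k≤
    ...   | x , y , x∈ , y∈ , x≺y =
      contradiction (trans (∈-subset⁻ level? x∈) (sym (∈-subset⁻ level? y∈))) (<⇒≢ (rank-mono x≺y))
      where level? = λ v → rank v ≟ c

    ∣levelsBelow∣≤ : ∀ c → ∣ levelsBelow c ∣ ≤ c * k
    ∣levelsBelow∣≤ zero = begin
      ∣ levelsBelow 0 ∣ ≤⟨ p⊆q⇒∣p∣≤∣q∣ {q = ⊥} (λ v∈ → contradiction (∈-subset⁻ (λ v → rank v <? 0) v∈) λ ()) ⟩
      ∣ ⊥ {n} ∣         ≡⟨ ∣⊥∣≡0 n ⟩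
      0                 ∎
      where open ≤-Reasoning
    ∣levelsBelow∣≤ (suc c) = begin
      ∣ levelsBelow (suc c) ∣                ≤⟨ p⊆q⇒∣p∣≤∣q∣ split ⟩
      ∣ levelsBelow c ∪ level c ∣            ≤⟨ ∣p∪q∣≤∣p∣+∣q∣ (levelsBelow c) (level c) ⟩
      ∣ levelsBelow c ∣ + ∣ level c ∣        ≤⟨ +-mono-≤ (∣levelsBelow∣≤ c) (<⇒≤ (∣level∣<k c)) ⟩
      c * k + k                              ≡⟨ +-comm (c * k) k ⟩
      suc c * k                              ∎
      where
      open ≤-Reasoning
      split : levelsBelow (suc c) ⊆ levelsBelow c ∪ level c
      split {v} v∈ with rank v <? c
      ... | yes r<c = x∈p∪q⁺ (inj₁ (∈-subset⁺ (λ v → rank v <? c) r<c))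
      ... | no r≮c  = x∈p∪q⁺ (inj₂ (∈-subset⁺ (λ v → rank v ≟ c) r≡c))
        where r≡c = ≤-antisym (s≤s⁻¹ (∈-subset⁻ (λ v → rank v <? suc c) v∈)) (≮⇒≥ r≮c)

threshold : ∀ k n → 0 < k → 6 * k < n → ∃ λ c → n ≤ 3 * k * c × c * k + c * k < n
threshold k@(suc _) n _ 6k<n = suc q , n≤3kc , *-cancelˡ-< 3 _ _ 3*[ck+ck]<3*n
  where
  d = 3 * k
  q = n / d

  n≤3kc : n ≤ d * suc q
  n≤3kc = <⇒≤ (begin-strict
    n            ≡⟨ m≡m%n+[m/n]*n n d ⟩
    n % d + q * d <⟨ +-monoˡ-< (q * d) (m%n<n n d) ⟩
    d + q * d    ≡⟨ *-comm (suc q) d ⟩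
    d * suc q    ∎)
    where open ≤-Reasoning

  3*[ck+ck]<3*n : 3 * (suc q * k + suc q * k) < 3 * n
  3*[ck+ck]<3*n = begin-strict
    3 * (suc q * k + suc q * k) ≡⟨ solve 2 (λ q k → con 3 :* ((con 1 :+ q) :* k :+ (con 1 :+ q) :* k)
                                                   := con 2 :* (q :* (con 3 :* k)) :+ con 6 :* k) refl q k ⟩
    2 * (q * d) + 6 * k         ≤⟨ +-monoˡ-≤ (6 * k) (*-monoʳ-≤ 2 (m/n*n≤m n d)) ⟩
    2 * n + 6 * k               <⟨ +-monoʳ-< (2 * n) 6k<n ⟩
    2 * n + n                   ≡⟨ solve 1 (λ n → con 2 :* n :+ n := con 3 :* n) refl n ⟩
    3 * n                       ∎
    where open ≤-Reasoning
          open +-*-Solver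

module AcyclicGraph {n : ℕ} (E : Rel (Fin n) 0ℓ) (E? : Decidable E) (acyclic : Acyclic E) where

  reach? : Decidable (Reach E)
  reach? = Reach? E E? acyclic

  module Ancestors   = Ranking reach? _++_ acyclic
  module Descendants = Ranking (flip reach?) (flip _++_) acyclic

  ∃-vertex-with-c-ancestors-and-descendants : ∀ {k c} → EveryKSetHasEdge k E → c * k + c * k < n →
    ∃ λ u → c ≤ Ancestors.rank u × c ≤ Descendants.rank u
  ∃-vertex-with-c-ancestors-and-descendants {k} {c} hasEdge 2ck<n =
    let u , u∉₋ , u∉₊ = ∣p∣+∣q∣<n⇒∃x∉p∪q (Ancestors.levelsBelow c) (Descendants.levelsBelow c) few-low-ranks
    in u , Ancestors.∉levelsBelow⇒≥ u∉₋ , Descendants.∉levelsBelow⇒≥ u∉₊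
    where
    hasReachEdge : EveryKSetHasEdge k (Reach E)
    hasReachEdge = EveryKSetHasEdge-map {R = Reach E} [_] hasEdge

    few-low-ranks : ∣ Ancestors.levelsBelow c ∣ + ∣ Descendants.levelsBelow c ∣ < n
    few-low-ranks = begin-strict
      ∣ Ancestors.levelsBelow c ∣ + ∣ Descendants.levelsBelow c ∣
        ≤⟨ +-mono-≤ (Ancestors.∣levelsBelow∣≤ hasReachEdge c)
                    (Descendants.∣levelsBelow∣≤ (EveryKSetHasEdge-flip {R = Reach E} hasReachEdge) c) ⟩
      c * k + c * k
        <⟨ 2ck<n ⟩
      n ∎
      where open ≤-Reasoning

lemma4p1 : (k n : ℕ) → 0 < k → 10 * k < n →
    (E : Rel (Fin n) 0ℓ) → Decidable E →
    Acyclic E → EveryKSetHasEdge k E →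
    Σ (Fin n) λ u → Σ (Subset n) λ S₋ → Σ (Subset n) λ S₊ →
    (∀ x → x ∈ S₋ → Reach E x u) × (∀ x → x ∈ S₊ → Reach E u x) ×
    (n ≤ 3 * k * ∣ S₋ ∣) × (n ≤ 3 * k * ∣ S₊ ∣)
lemma4p1 k n 0<k 10k<n E E? acyclic hasEdge =
  let c , n≤3kc , 2kc<n = threshold k n 0<k (≤-<-trans (*-monoˡ-≤ k (m≤m+n 6 4)) 10k<n)
      u , c≤∣S₋∣ , c≤∣S₊∣ = ∃-vertex-with-c-ancestors-and-descendants hasEdge 2kc<n
  in u , Ancestors.predecessors u , Descendants.predecessors u
   , (λ x → ∈-subset⁻ (λ x → reach? x u)) , (λ x → ∈-subset⁻ (λ x → reach? u x))
   , ≤-trans n≤3kc (*-monoʳ-≤ (3 * k) c≤∣S₋∣)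
   , ≤-trans n≤3kc (*-monoʳ-≤ (3 * k) c≤∣S₊∣)
  where open AcyclicGraph E E? acyclic
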